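{- For all $0\le h\le k$, let $\psi(h,k)$ be the lexicographically least overlap-free word over $\mathbb{N}$ that starts with the letter $h$ and ends with the letter $k$. Then $\psi(h,k)=\varphi^{k-h}(h)$.
   Context: $\mathbb{N}=\{0,1,2,\ldots\}$ is an alphabet with its usual order; $x\cdot y$ denotes concatenation. An overlap is a word $cxcxc$ with $c$ a letter and $x$ a possibly empty word; overlap-free means having no overlap as a factor. Lexicographic order: $x\le y$ if $x$ is a prefix of $y$ or $x=wcx'$, $y=wdy'$ with letters $c<d$. $S^{ -1}$ is the right cyclic shift, $S^{ -1}(xc)=cx$. The morphism $\varphi\colon\mathbb{N}^*\to\mathbb{N}^*$ is defined recursively by $\varphi(h)=S^{ -1}(\varphi^h(00))\cdot(h+1)$ (well defined since $\varphi^h(00)$ involves only $\varphi$ on letters $<h$); e.g. $\varphi(0)=001$, $\varphi(1)=1001002$. -}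

module Defs where

open import Data.Nat using (ℕ; zero; suc; _<_; _<ᵇ_; _≡ᵇ_)
open import Data.Bool using (if_then_else_)
open import Data.List using (List; []; _∷_; _++_; reverse; concatMap; [_])
open import Data.Product using (∃; ∃-syntax; _×_)
open import Data.Sum using (_⊎_)
open import Relation.Binary.PropositionalEquality using (_≡_)
open import Relation.Nullary using (¬_)

Word : Set
Word = List ℕ

iter : ℕ → (Word → Word) → Word → Word
iter zero    f w = w
iter (suc n) f w = f (iter n f w)

shiftR : Word → Word
shiftR w with reverse w
... | []    = []
... | c ∷ r = c ∷ reverse r

-- phiT n c = φ(c) if c < n, and [] otherwise (the morphism φ restricted to
-- letters < n).  φ(n) = S⁻¹(φⁿ(00)) · (n+1), where φⁿ(00) only uses φ on
-- letters < n.
phiT : ℕ → ℕ → Word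
phiT zero    c = []
phiT (suc n) c =
  if c <ᵇ n then phiT n c
  else if c ≡ᵇ n then shiftR (iter n (concatMap (phiT n)) (0 ∷ 0 ∷ [])) ++ [ suc n ]
  else []

φ-letter : ℕ → Word
φ-letter c = phiT (suc c) c

φ : Word → Word
φ = concatMap φ-letter

Factor : Word → Word → Set
Factor f w = ∃[ u ] ∃[ v ] (w ≡ u ++ f ++ v)

IsOverlap : Word → Set
IsOverlap o = ∃[ c ] ∃[ x ] (o ≡ c ∷ x ++ c ∷ x ++ [ c ])

OverlapFree : Word → Set
OverlapFree w = ¬ (∃[ o ] (IsOverlap o × Factor o w))

StartsWith : ℕ → Word → Set
StartsWith h w = ∃[ t ] (w ≡ h ∷ t)

EndsWith : ℕ → Word → Set
EndsWith k w = ∃[ t ] (w ≡ t ++ [ k ])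

_≤lex_ : Word → Word → Set
x ≤lex y =
  (∃[ z ] (y ≡ x ++ z))
  ⊎ (∃[ w ] ∃[ c ] ∃[ d ] ∃[ x′ ] ∃[ y′ ]
       (c < d × x ≡ w ++ c ∷ x′ × y ≡ w ++ d ∷ y′))

IsLexLeast : (Word → Set) → Word → Set
IsLexLeast P w = P w × (∀ v → P v → w ≤lex v)

OFFromTo : ℕ → ℕ → Word → Set
OFFromTo h k w = OverlapFree w × StartsWith h w × EndsWith k w

-- Write u = stem, so u(0) = ε and u(a+1) = φ(u(a)) a u(a) a u(a).  Then
-- φ(a) = a u(a) a u(a) (a+1), φʲ(00) = u(j) j u(j) j and φ(u(a) a) = u(a+1) (a+1).
-- A maximal-letter argument shows that φ(X) is overlap-free whenever X and the words
-- u(c) for the letters c of X are; so every u(a) and every φⁿ(h) is overlap-free.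
-- Moreover φⁿ(h) is greedy: replacing any of its letters but the first by a smaller
-- letter c completes a factor c x c x c, and this property is transported by φ
-- because φʲ(00) has it.  Hence an overlap-free word from h to k = h + n is larger
-- than φⁿ(h) at their first difference, or extends it; and it cannot properly extend
-- it, since the letter k occurs in φⁿ(h) only at the end.

module Submission where

open import Defs
open import Data.Bool using (false; true)
open import Data.Empty using (⊥; ⊥-elim)
open import Data.List using ([]; _∷_; _++_; [_]; reverse; concatMap; length; take)
open import Data.List.Properties
  using (++-assoc; ++-identityʳ; ++-conicalʳ; ++-monoid; ∷-injectiveˡ; ∷-injectiveʳ;
         concatMap-++; length-++; reverse-++; reverse-involutive)
open import Data.List.Relation.Unary.All as All using (All; []; _∷_)
open import Data.List.Relation.Unary.All.Properties using (++⁺; ++⁻ʳ)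
open import Data.Nat
  using (ℕ; zero; suc; _+_; _∸_; _<_; _≤_; _⊔_; _<ᵇ_; _≡ᵇ_; _≟_; _<?_; _≤?_; z≤n; s≤s)
open import Data.Nat.Induction using (<-rec)
open import Data.Nat.Properties
open import Data.Nat.Tactic.RingSolver using (solve-∀)
open import Data.Product using (∃; ∃-syntax; _×_; _,_; proj₁; proj₂)
open import Data.Sum using (_⊎_; inj₁; inj₂; [_,_]′)
open import Relation.Binary using (tri<; tri≈; tri>)
open import Relation.Binary.PropositionalEquality
  using (_≡_; _≢_; refl; sym; trans; cong; cong₂; subst; subst₂; module ≡-Reasoning)
open import Relation.Nullary using (¬_; Dec; yes; no)

open import Algebra.Solver.Monoid (++-monoid ℕ) using (solve; _⊕_; _⊜_; id)

-- The blocks φ(a)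

stem : ℕ → Word
stem zero    = []
stem (suc a) = φ (stem a) ++ a ∷ stem a ++ a ∷ stem a

block : ℕ → Word
block c = c ∷ stem c ++ c ∷ stem c ++ [ suc c ]

stemSquare : ℕ → Word
stemSquare j = stem j ++ j ∷ stem j ++ [ j ]

blocks : Word → Word
blocks = concatMap block

<ᵇ-irrefl : ∀ n → (n <ᵇ n) ≡ false
<ᵇ-irrefl zero    = refl
<ᵇ-irrefl (suc n) = <ᵇ-irrefl n

≡ᵇ-refl : ∀ n → (n ≡ᵇ n) ≡ true
≡ᵇ-refl zero    = refl
≡ᵇ-refl (suc n) = ≡ᵇ-refl n

<⇒<ᵇ≡true : ∀ {c n} → c < n → (c <ᵇ n) ≡ true
<⇒<ᵇ≡true {zero}  {suc n} _         = refl
<⇒<ᵇ≡true {suc c} {suc n} (s≤s c<n) = <⇒<ᵇ≡true c<n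

phiT-<⇒φ-letter : ∀ n c → c < n → phiT n c ≡ φ-letter c
phiT-<⇒φ-letter (suc n) c (s≤s c≤n) with m≤n⇒m<n∨m≡n c≤n
... | inj₁ c<n  rewrite <⇒<ᵇ≡true c<n = phiT-<⇒φ-letter n c c<n
... | inj₂ refl rewrite <ᵇ-irrefl c | ≡ᵇ-refl c = refl

shiftR-∷ʳ : ∀ xs n → shiftR (xs ++ [ n ]) ≡ n ∷ xs
shiftR-∷ʳ xs n rewrite reverse-++ xs [ n ] | reverse-involutive xs = refl

concatMap-cong-All : ∀ {f g : ℕ → Word} {P : ℕ → Set} →
  (∀ c → P c → f c ≡ g c) → ∀ {xs} → All P xs → concatMap f xs ≡ concatMap g xs
concatMap-cong-All f≗g []         = refl
concatMap-cong-All f≗g (px ∷ pxs) = cong₂ _++_ (f≗g _ px) (concatMap-cong-All f≗g pxs)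

All<-weaken : ∀ {a b} → a ≤ b → ∀ {xs} → All (_< a) xs → All (_< b) xs
All<-weaken a≤b = All.map (λ c<a → ≤-trans c<a a≤b)

blocks-stemSquare : ∀ j → blocks (stemSquare j) ≡ blocks (stem j) ++ block j ++ blocks (stem j) ++ block j
blocks-stemSquare j = begin
  blocks (stem j ++ j ∷ stem j ++ [ j ])
    ≡⟨ concatMap-++ block (stem j) _ ⟩
  blocks (stem j) ++ block j ++ blocks (stem j ++ [ j ])
    ≡⟨ cong (λ z → blocks (stem j) ++ block j ++ z) (concatMap-++ block (stem j) [ j ]) ⟩
  blocks (stem j) ++ block j ++ blocks (stem j) ++ block j ++ []
    ≡⟨ cong (λ z → blocks (stem j) ++ block j ++ blocks (stem j) ++ z) (++-identityʳ (block j)) ⟩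
  blocks (stem j) ++ block j ++ blocks (stem j) ++ block j ∎
  where open ≡-Reasoning

blocks-stemSquare≡stemSquare-suc : ∀ j → φ (stem j) ≡ blocks (stem j) → blocks (stemSquare j) ≡ stemSquare (suc j)
blocks-stemSquare≡stemSquare-suc j eq rewrite blocks-stemSquare j | eq =
  solve 4 (λ V J U S → V ⊕ (J ⊕ U ⊕ J ⊕ U ⊕ S) ⊕ V ⊕ (J ⊕ U ⊕ J ⊕ U ⊕ S)
                     ⊜ (V ⊕ J ⊕ U ⊕ J ⊕ U) ⊕ S ⊕ (V ⊕ J ⊕ U ⊕ J ⊕ U) ⊕ S)
        refl (blocks (stem j)) [ j ] (stem j) [ suc j ]

stemSquare-< : ∀ j → All (_< j) (stem j) → All (_< suc j) (stemSquare j)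
stemSquare-< j s<j = ++⁺ s<sj (n<1+n j ∷ ++⁺ s<sj (n<1+n j ∷ []))
  where s<sj = All<-weaken (n≤1+n j) s<j

block-< : ∀ c → All (_< c) (stem c) → All (_< suc (suc c)) (block c)
block-< c s<c = c<2+c ∷ ++⁺ s< (c<2+c ∷ ++⁺ s< (n<1+n (suc c) ∷ []))
  where
  c<2+c = m<n⇒m<1+n (n<1+n c)
  s<    = All<-weaken (≤-trans (n≤1+n c) (n≤1+n (suc c))) s<c

blocks-<′ : ∀ n → (∀ c → c < n → All (_< c) (stem c)) → ∀ {w} → All (_< n) w → All (_< suc n) (blocks w)
blocks-<′ n stem< []          = []
blocks-<′ n stem< (c<n ∷ w<n) =
  ++⁺ (All<-weaken (s≤s c<n) (block-< _ (stem< _ c<n))) (blocks-<′ n stem< w<n)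

BlockFormBelow : ℕ → Set
BlockFormBelow n = ∀ c → c < n → φ-letter c ≡ block c

StemBoundUpTo : ℕ → Set
StemBoundUpTo n = ∀ c → c ≤ n → All (_< c) (stem c)

module _ {n} (blockForm : BlockFormBelow n) where

  φ≡blocks-below : ∀ {w} → All (_< n) w → φ w ≡ blocks w
  φ≡blocks-below = concatMap-cong-All blockForm

  phiT≡blocks-below : ∀ {w} → All (_< n) w → concatMap (phiT n) w ≡ blocks w
  phiT≡blocks-below = concatMap-cong-All (λ c c<n → trans (phiT-<⇒φ-letter n c c<n) (blockForm c c<n))

  iter-phiT-00≡stemSquare : StemBoundUpTo n →
    ∀ j → j ≤ n → iter j (concatMap (phiT n)) (0 ∷ 0 ∷ []) ≡ stemSquare j
  iter-phiT-00≡stemSquare stemBound zero    _   = refl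
  iter-phiT-00≡stemSquare stemBound (suc j) j<n
    rewrite iter-phiT-00≡stemSquare stemBound j (<⇒≤ j<n) =
    trans (phiT≡blocks-below (All<-weaken j<n (stemSquare-< j stem<)))
          (blocks-stemSquare≡stemSquare-suc j (φ≡blocks-below (All<-weaken (<⇒≤ j<n) stem<)))
    where stem< = stemBound j (<⇒≤ j<n)

  φ-letter≡block-at : StemBoundUpTo n → φ-letter n ≡ block n
  φ-letter≡block-at stemBound
    rewrite <ᵇ-irrefl n | ≡ᵇ-refl n | iter-phiT-00≡stemSquare stemBound n ≤-refl
          | sym (++-assoc (stem n) (n ∷ stem n) [ n ]) | shiftR-∷ʳ (stem n ++ n ∷ stem n) n =
    cong (n ∷_) (++-assoc (stem n) (n ∷ stem n) [ suc n ])

-- φ(c) is computed from φ on smaller letters, so the block form and the bound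
-- on the letters of the stems are established together, letter by letter.
blockForm×stemBound : ∀ n → BlockFormBelow n × StemBoundUpTo n
blockForm×stemBound zero = (λ c ()) , λ { zero z≤n → [] }
blockForm×stemBound (suc n) with blockForm×stemBound n
... | blockForm , stemBound = blockForm′ , stemBound′
  where
  blockForm′ : BlockFormBelow (suc n)
  blockForm′ c (s≤s c≤n) with m≤n⇒m<n∨m≡n c≤n
  ... | inj₁ c<n  = blockForm c c<n
  ... | inj₂ refl = φ-letter≡block-at blockForm stemBound

  stemBound′ : StemBoundUpTo (suc n)
  stemBound′ c c≤1+n with m≤n⇒m<n∨m≡n c≤1+n
  ... | inj₁ (s≤s c≤n) = stemBound c c≤n
  ... | inj₂ refl rewrite φ≡blocks-below blockForm (stemBound n ≤-refl) =
    ++⁺ (blocks-<′ n (λ c c<n → stemBound c (<⇒≤ c<n)) stem<)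
        (n<1+n n ∷ ++⁺ stem<1+n (n<1+n n ∷ stem<1+n))
    where
    stem<    = stemBound n ≤-refl
    stem<1+n = All<-weaken (n≤1+n n) stem<

φ-letter≡block : ∀ c → φ-letter c ≡ block c
φ-letter≡block c = proj₁ (blockForm×stemBound (suc c)) c ≤-refl

stem-< : ∀ c → All (_< c) (stem c)
stem-< c = proj₂ (blockForm×stemBound c) c ≤-refl

φ≡blocks : ∀ w → φ w ≡ blocks w
φ≡blocks []      = refl
φ≡blocks (c ∷ w) = cong₂ _++_ (φ-letter≡block c) (φ≡blocks w)

blocks-< : ∀ n {w} → All (_< n) w → All (_< suc n) (blocks w)
blocks-< n = blocks-<′ n (λ c _ → stem-< c)


-- Positions in words

-- The letter at a position, with the junk value 0 past the end of the word.
at : Word → ℕ → ℕ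
at []       _       = 0
at (x ∷ xs) zero    = x
at (x ∷ xs) (suc n) = at xs n

at-++ˡ : ∀ w z j → j < length w → at (w ++ z) j ≡ at w j
at-++ˡ (x ∷ w) z zero    _         = refl
at-++ˡ (x ∷ w) z (suc j) (s≤s j<w) = at-++ˡ w z j j<w

at-++ʳ : ∀ w z j → at (w ++ z) (length w + j) ≡ at z j
at-++ʳ []      z j = refl
at-++ʳ (x ∷ w) z j = at-++ʳ w z j

All-at : ∀ {P : ℕ → Set} {xs} → All P xs → ∀ r → r < length xs → P (at xs r)
All-at (p ∷ ps) zero    _         = p
All-at (p ∷ ps) (suc r) (s≤s r<n) = All-at ps r r<n

HasPeriodAt : Word → ℕ → ℕ → Set
HasPeriodAt w i p = ∀ j → j ≤ p → at w (i + j) ≡ at w (i + j + p)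

-- An overlap c x c x c occupying the positions i, …, i + 2p of w, where p = |c x|.
Overlap : Word → ℕ → ℕ → Set
Overlap w i p = 0 < p × i + p + p < length w × HasPeriodAt w i p

OverlapFree′ : Word → Set
OverlapFree′ w = ∀ i p → ¬ Overlap w i p

overlap-++ʳ : ∀ w z {i p} → Overlap w i p → Overlap (w ++ z) i p
overlap-++ʳ w z {i} {p} (p>0 , fits , period) = p>0 , fits′ , period′
  where
  fits′ : i + p + p < length (w ++ z)
  fits′ = <-≤-trans fits (subst (length w ≤_) (sym (length-++ w)) (m≤m+n (length w) (length z)))

  period′ : HasPeriodAt (w ++ z) i p
  period′ j j≤p = begin
    at (w ++ z) (i + j)     ≡⟨ at-++ˡ w z (i + j) (≤-<-trans (≤-trans (+-monoʳ-≤ i j≤p) (m≤m+n (i + p) p)) fits) ⟩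
    at w (i + j)            ≡⟨ period j j≤p ⟩
    at w (i + j + p)        ≡⟨ at-++ˡ w z (i + j + p) (≤-<-trans (+-monoˡ-≤ p (+-monoʳ-≤ i j≤p)) fits) ⟨
    at (w ++ z) (i + j + p) ∎
    where open ≡-Reasoning

overlap-++ˡ : ∀ u w {i p} → Overlap w i p → Overlap (u ++ w) (length u + i) p
overlap-++ˡ u w {i} {p} (p>0 , fits , period) = p>0 , fits′ , period′
  where
  fits′ : length u + i + p + p < length (u ++ w)
  fits′ = subst₂ _<_ (arith (length u) i p) (sym (length-++ u)) (+-monoʳ-< (length u) fits)
    where
    arith : ∀ n i p → n + (i + p + p) ≡ n + i + p + p
    arith = solve-∀

  period′ : HasPeriodAt (u ++ w) (length u + i) p
  period′ j j≤p = begin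
    at (u ++ w) (length u + i + j)     ≡⟨ cong (at (u ++ w)) (+-assoc (length u) i j) ⟩
    at (u ++ w) (length u + (i + j))   ≡⟨ at-++ʳ u w (i + j) ⟩
    at w (i + j)                       ≡⟨ period j j≤p ⟩
    at w (i + j + p)                   ≡⟨ at-++ʳ u w (i + j + p) ⟨
    at (u ++ w) (length u + (i + j + p)) ≡⟨ cong (at (u ++ w)) (arith (length u) i j p) ⟩
    at (u ++ w) (length u + i + j + p) ∎
    where
    open ≡-Reasoning
    arith : ∀ n i j p → n + (i + j + p) ≡ n + i + j + p
    arith = solve-∀

overlap-cxcxc : ∀ c x → Overlap (c ∷ x ++ c ∷ x ++ [ c ]) 0 (suc (length x))
overlap-cxcxc c x = s≤s z≤n , fits , period
  where
  cx = c ∷ x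
  p  = length cx

  fits : p + p < length (cx ++ cx ++ [ c ])
  fits = subst (p + p <_) (sym (trans (length-++ cx) (cong (p +_) (trans (length-++ cx) (+-comm p 1)))))
               (+-monoʳ-< p (n<1+n p))

  period : HasPeriodAt (cx ++ cx ++ [ c ]) 0 p
  period j j≤p with m≤n⇒m<n∨m≡n j≤p
  ... | inj₁ j<p = begin
    at (cx ++ cx ++ [ c ]) j       ≡⟨ at-++ˡ cx _ j j<p ⟩
    at cx j                        ≡⟨ at-++ˡ cx [ c ] j j<p ⟨
    at (cx ++ [ c ]) j             ≡⟨ at-++ʳ cx _ j ⟨
    at (cx ++ cx ++ [ c ]) (p + j) ≡⟨ cong (at (cx ++ cx ++ [ c ])) (+-comm p j) ⟩
    at (cx ++ cx ++ [ c ]) (j + p) ∎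
    where open ≡-Reasoning
  ... | inj₂ refl = begin
    at (cx ++ cx ++ [ c ]) p       ≡⟨ cong (at (cx ++ cx ++ [ c ])) (+-identityʳ p) ⟨
    at (cx ++ cx ++ [ c ]) (p + 0) ≡⟨ at-++ʳ cx _ 0 ⟩
    c                              ≡⟨ at-++ʳ cx [ c ] 0 ⟨
    at (cx ++ [ c ]) (p + 0)       ≡⟨ cong (at (cx ++ [ c ])) (+-identityʳ p) ⟩
    at (cx ++ [ c ]) p             ≡⟨ at-++ʳ cx _ p ⟨
    at (cx ++ cx ++ [ c ]) (p + p) ∎
    where open ≡-Reasoning

overlapFree′-prefix : ∀ w z → OverlapFree′ (w ++ z) → OverlapFree′ w
overlapFree′-prefix w z noOverlap i p ov = noOverlap i p (overlap-++ʳ w z ov)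

overlapFree′⇒overlapFree : ∀ w → OverlapFree′ w → OverlapFree w
overlapFree′⇒overlapFree _ noOverlap (_ , (c , x , refl) , (u , v , refl)) =
  noOverlap _ _ (overlap-++ˡ u _ {0} (overlap-++ʳ _ v {0} (overlap-cxcxc c x)))

blockLen : ℕ → ℕ
blockLen a = length (block a)

halfLen : ℕ → ℕ
halfLen a = suc (length (stem a))

blockLen≡ : ∀ a → blockLen a ≡ suc (halfLen a + halfLen a)
blockLen≡ a = trans (cong suc (length-++ (stem a)))
  (trans (cong (λ t → suc (length (stem a) + suc t)) (length-++ (stem a))) (arith (length (stem a))))
  where
  arith : ∀ n → suc (n + suc (n + 1)) ≡ suc (suc n + suc n)
  arith = solve-∀

0<blockLen : ∀ a → 0 < blockLen a
0<blockLen a = s≤s z≤n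

halfLen<blockLen : ∀ a → halfLen a < blockLen a
halfLen<blockLen a = subst (halfLen a <_) (sym (blockLen≡ a)) (s≤s (m≤m+n (halfLen a) (halfLen a)))

2halfLen<blockLen : ∀ a → halfLen a + halfLen a < blockLen a
2halfLen<blockLen a = subst (halfLen a + halfLen a <_) (sym (blockLen≡ a)) ≤-refl

blockStart : Word → ℕ → ℕ
blockStart X k = length (blocks (take k X))

blockStart-suc : ∀ X k → k < length X → blockStart X (suc k) ≡ blockStart X k + blockLen (at X k)
blockStart-suc (x ∷ xs) zero    _         = cong length (++-identityʳ (block x))
blockStart-suc (x ∷ xs) (suc k) (s≤s k<n) = begin
  length (block x ++ blocks (take (suc k) xs))  ≡⟨ length-++ (block x) ⟩
  blockLen x + blockStart xs (suc k)             ≡⟨ cong (blockLen x +_) (blockStart-suc xs k k<n) ⟩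
  blockLen x + (blockStart xs k + blockLen (at xs k)) ≡⟨ +-assoc (blockLen x) _ _ ⟨
  blockLen x + blockStart xs k + blockLen (at xs k)   ≡⟨ cong (_+ blockLen (at xs k)) (length-++ (block x)) ⟨
  blockStart (x ∷ xs) (suc k) + blockLen (at xs k) ∎
  where open ≡-Reasoning

blockStart-length : ∀ X → blockStart X (length X) ≡ length (blocks X)
blockStart-length []       = refl
blockStart-length (x ∷ xs) =
  trans (length-++ (block x)) (trans (cong (blockLen x +_) (blockStart-length xs)) (sym (length-++ (block x))))

blockStart-mono-≤ : ∀ X {k k′} → k ≤ k′ → blockStart X k ≤ blockStart X k′
blockStart-mono-≤ X        {zero}          _         = z≤n
blockStart-mono-≤ []       {suc k} {suc k′} _         = z≤n
blockStart-mono-≤ (x ∷ xs) {suc k} {suc k′} (s≤s k≤k′) =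
  subst₂ _≤_ (sym (length-++ (block x))) (sym (length-++ (block x)))
    (+-monoʳ-≤ (blockLen x) (blockStart-mono-≤ xs k≤k′))

blockEnd≤blockStart : ∀ X {k k′} → k < k′ → k < length X → blockStart X k + blockLen (at X k) ≤ blockStart X k′
blockEnd≤blockStart X {k} k<k′ k<n = subst (_≤ _) (blockStart-suc X k k<n) (blockStart-mono-≤ X k<k′)

blockMiddle : Word → ℕ → ℕ
blockMiddle X k = blockStart X k + halfLen (at X k)

blockLast : Word → ℕ → ℕ
blockLast X k = blockStart X k + (halfLen (at X k) + halfLen (at X k))

blockStart-suc≡suc-blockLast : ∀ X k → k < length X → blockStart X (suc k) ≡ suc (blockLast X k)
blockStart-suc≡suc-blockLast X k k<n = begin
  blockStart X (suc k)                                      ≡⟨ blockStart-suc X k k<n ⟩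
  blockStart X k + blockLen (at X k)                        ≡⟨ cong (blockStart X k +_) (blockLen≡ (at X k)) ⟩
  blockStart X k + suc (halfLen (at X k) + halfLen (at X k)) ≡⟨ +-suc (blockStart X k) _ ⟩
  suc (blockLast X k) ∎
  where open ≡-Reasoning

at-blocks : ∀ X k o → k < length X → o < blockLen (at X k) →
  at (blocks X) (blockStart X k + o) ≡ at (block (at X k)) o
at-blocks (x ∷ xs) zero    o _         o<B = at-++ˡ (block x) (blocks xs) o o<B
at-blocks (x ∷ xs) (suc k) o (s≤s k<n) o<B = begin
  at (block x ++ blocks xs) (blockStart (x ∷ xs) (suc k) + o)
    ≡⟨ cong (λ t → at (block x ++ blocks xs) (t + o)) (length-++ (block x)) ⟩
  at (block x ++ blocks xs) (blockLen x + blockStart xs k + o)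
    ≡⟨ cong (at (block x ++ blocks xs)) (+-assoc (blockLen x) _ o) ⟩
  at (block x ++ blocks xs) (blockLen x + (blockStart xs k + o))
    ≡⟨ at-++ʳ (block x) (blocks xs) _ ⟩
  at (blocks xs) (blockStart xs k + o)
    ≡⟨ at-blocks xs k o k<n o<B ⟩
  at (block (at xs k)) o ∎
  where open ≡-Reasoning

blocks-position : ∀ X q → q < length (blocks X) →
  ∃[ k ] ∃[ o ] (k < length X × o < blockLen (at X k) × q ≡ blockStart X k + o)
blocks-position (x ∷ xs) q q<n with q <? blockLen x
... | yes q<B = 0 , q , s≤s z≤n , q<B , refl
... | no q≮B with blocks-position xs (q ∸ blockLen x) q′<n
  where
  q′<n : q ∸ blockLen x < length (blocks xs)
  q′<n = +-cancelˡ-< (blockLen x) _ _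
           (subst₂ _<_ (sym (m+[n∸m]≡n (≮⇒≥ q≮B))) (length-++ (block x)) q<n)
... | k , o , k<n , o<B , q′≡ = suc k , o , s≤s k<n , o<B , (begin
  q                                    ≡⟨ m+[n∸m]≡n (≮⇒≥ q≮B) ⟨
  blockLen x + (q ∸ blockLen x)        ≡⟨ cong (blockLen x +_) q′≡ ⟩
  blockLen x + (blockStart xs k + o)   ≡⟨ +-assoc (blockLen x) _ o ⟨
  blockLen x + blockStart xs k + o     ≡⟨ cong (_+ o) (length-++ (block x)) ⟨
  blockStart (x ∷ xs) (suc k) + o ∎)
  where open ≡-Reasoning

blockStart-injective : ∀ X {k k′ o o′} → k < length X → k′ < length X →
  o < blockLen (at X k) → o′ < blockLen (at X k′) →
  blockStart X k + o ≡ blockStart X k′ + o′ → k ≡ k′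
blockStart-injective X {k} {k′} {o} {o′} k<n k′<n o<B o′<B eq with <-cmp k k′
... | tri≈ _ k≡k′ _ = k≡k′
... | tri< k<k′ _ _ = ⊥-elim (<-irrefl eq (≤-trans (+-monoʳ-< (blockStart X k) o<B)
                        (≤-trans (blockEnd≤blockStart X k<k′ k<n) (m≤m+n (blockStart X k′) o′))))
... | tri> _ _ k′<k = ⊥-elim (<-irrefl (sym eq) (≤-trans (+-monoʳ-< (blockStart X k′) o′<B)
                        (≤-trans (blockEnd≤blockStart X k′<k k′<n) (m≤m+n (blockStart X k) o))))

∷stem-ends-with-0 : ∀ a → ∃[ w ] (a ∷ stem a ≡ w ++ [ 0 ])
∷stem-ends-with-0 zero    = [] , refl
∷stem-ends-with-0 (suc a) with ∷stem-ends-with-0 a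
... | w , eq = suc a ∷ φ (stem a) ++ w ++ 0 ∷ w ,
  trans (cong (λ t → suc a ∷ φ (stem a) ++ t ++ t) eq)
        (solve 4 (λ S F W Z → S ⊕ F ⊕ (W ⊕ Z) ⊕ (W ⊕ Z) ⊜ (S ⊕ F ⊕ W ⊕ Z ⊕ W) ⊕ Z)
               refl [ suc a ] (φ (stem a)) w [ 0 ])

∷stem-at-last : ∀ a → at (a ∷ stem a) (length (stem a)) ≡ 0
∷stem-at-last a with ∷stem-ends-with-0 a
... | w , eq = begin
  at (a ∷ stem a) (length (stem a)) ≡⟨ cong₂ at eq |stem|≡|w| ⟩
  at (w ++ [ 0 ]) (length w)        ≡⟨ cong (at (w ++ [ 0 ])) (+-identityʳ (length w)) ⟨
  at (w ++ [ 0 ]) (length w + 0)    ≡⟨ at-++ʳ w [ 0 ] 0 ⟩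
  0 ∎
  where
  open ≡-Reasoning
  |stem|≡|w| : length (stem a) ≡ length w
  |stem|≡|w| = suc-injective (trans (cong length eq) (trans (length-++ w) (+-comm (length w) 1)))

block-at-stem₁ : ∀ a r → r < length (stem a) → at (block a) (suc r) ≡ at (stem a) r
block-at-stem₁ a r r<n = at-++ˡ (stem a) _ r r<n

block-at-half : ∀ a → at (block a) (halfLen a) ≡ a
block-at-half a =
  trans (cong (at (stem a ++ a ∷ stem a ++ [ suc a ])) (sym (+-identityʳ (length (stem a)))))
        (at-++ʳ (stem a) _ 0)

block-at-stem₂ : ∀ a r → r < length (stem a) → at (block a) (halfLen a + suc r) ≡ at (stem a) r
block-at-stem₂ a r r<n = trans (at-++ʳ (stem a) _ (suc r)) (at-++ˡ (stem a) _ r r<n)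

block-at-end : ∀ a → at (block a) (halfLen a + halfLen a) ≡ suc a
block-at-end a = trans (at-++ʳ (stem a) _ (suc (length (stem a))))
  (trans (cong (at (stem a ++ [ suc a ])) (sym (+-identityʳ (length (stem a))))) (at-++ʳ (stem a) _ 0))

block-at-half∸1 : ∀ a → at (block a) (length (stem a)) ≡ 0
block-at-half∸1 a =
  trans (at-++ˡ (a ∷ stem a) ((a ∷ stem a) ++ [ suc a ]) (length (stem a)) (n<1+n _)) (∷stem-at-last a)

block-at-end∸1 : ∀ a → at (block a) (halfLen a + length (stem a)) ≡ 0
block-at-end∸1 a = trans (at-++ʳ (a ∷ stem a) ((a ∷ stem a) ++ [ suc a ]) (length (stem a)))
  (trans (at-++ˡ (a ∷ stem a) [ suc a ] (length (stem a)) (n<1+n _)) (∷stem-at-last a))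

stem-at-< : ∀ a r → r < length (stem a) → at (stem a) r < a
stem-at-< a r r<n = All-at (stem-< a) r r<n

data BlockOffset (a o : ℕ) : Set where
  atFirst  : o ≡ 0 → BlockOffset a o
  inStem₁  : ∀ r → r < length (stem a) → o ≡ suc r → BlockOffset a o
  atMiddle : o ≡ halfLen a → BlockOffset a o
  inStem₂  : ∀ r → r < length (stem a) → o ≡ halfLen a + suc r → BlockOffset a o
  atLast   : o ≡ halfLen a + halfLen a → BlockOffset a o

blockOffset : ∀ a o → o < blockLen a → BlockOffset a o
blockOffset a zero    _ = atFirst refl
blockOffset a (suc o) o<B with <-cmp o (length (stem a))
... | tri< o<n _ _ = inStem₁ o o<n refl
... | tri≈ _ refl _ = atMiddle refl
... | tri> _ _ o>n = second (o ∸ length (stem a)) (m<n⇒0<n∸m o>n) t≤L o≡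
  where
  o≡ : suc o ≡ halfLen a + (o ∸ length (stem a))
  o≡ = cong suc (sym (m+[n∸m]≡n (<⇒≤ o>n)))
  t≤L : o ∸ length (stem a) ≤ halfLen a
  t≤L = +-cancelˡ-≤ (halfLen a) _ _
          (subst (_≤ halfLen a + halfLen a) o≡ (≤-pred (subst (suc (suc o) ≤_) (blockLen≡ a) o<B)))
  second : ∀ t → 0 < t → t ≤ halfLen a → suc o ≡ halfLen a + t → BlockOffset a (suc o)
  second (suc r) _ (s≤s r≤n) eq with m≤n⇒m<n∨m≡n r≤n
  ... | inj₁ r<n  = inStem₂ r r<n eq
  ... | inj₂ refl = atLast eq

block-at≡⇒first⊎middle : ∀ a o → o < blockLen a → at (block a) o ≡ a → o ≡ 0 ⊎ o ≡ halfLen a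
block-at≡⇒first⊎middle a o o<B o≡a with blockOffset a o o<B
... | atFirst o≡0        = inj₁ o≡0
... | atMiddle o≡L       = inj₂ o≡L
... | inStem₁ r r<n refl = ⊥-elim (<-irrefl (trans (sym (block-at-stem₁ a r r<n)) o≡a) (stem-at-< a r r<n))
... | inStem₂ r r<n refl = ⊥-elim (<-irrefl (trans (sym (block-at-stem₂ a r r<n)) o≡a) (stem-at-< a r r<n))
... | atLast refl        = ⊥-elim (1+n≢n (trans (sym (block-at-end a)) o≡a))

-- φ preserves overlap-freeness

maxUpTo : (ℕ → ℕ) → ℕ → ℕ
maxUpTo f zero    = f 0
maxUpTo f (suc n) = maxUpTo f n ⊔ f (suc n)

≤maxUpTo : ∀ f n s → s ≤ n → f s ≤ maxUpTo f n
≤maxUpTo f zero    zero _   = ≤-refl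
≤maxUpTo f (suc n) s  s≤1+n with m≤n⇒m<n∨m≡n s≤1+n
... | inj₁ (s≤s s≤n) = ≤-trans (≤maxUpTo f n s s≤n) (m≤m⊔n (maxUpTo f n) _)
... | inj₂ refl      = m≤n⊔m (maxUpTo f n) _

maxUpTo-attained : ∀ f n → ∃[ s ] (s ≤ n × f s ≡ maxUpTo f n)
maxUpTo-attained f zero = 0 , z≤n , refl
maxUpTo-attained f (suc n) with ⊔-sel (maxUpTo f n) (f (suc n))
... | inj₂ eq = suc n , ≤-refl , sym eq
... | inj₁ eq with maxUpTo-attained f n
...   | s , s≤n , fs≡ = s , ≤-trans s≤n (n≤1+n n) , trans fs≡ (sym eq)

least-witness : (P : ℕ → Set) → (∀ n → Dec (P n)) → ∀ n → P n →
  ∃[ t ] (t ≤ n × P t × (∀ s → s < t → ¬ P s))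
least-witness P P? n Pn with least-below (suc n)
  where
  least-below : ∀ n → (∀ s → s < n → ¬ P s) ⊎ ∃[ t ] (t < n × P t × (∀ s → s < t → ¬ P s))
  least-below zero = inj₁ (λ s ())
  least-below (suc n) with least-below n
  ... | inj₂ (t , t<n , Pt , below) = inj₂ (t , m<n⇒m<1+n t<n , Pt , below)
  ... | inj₁ none with P? n
  ...   | yes Pn = inj₂ (n , n<1+n n , Pn , none)
  ...   | no ¬Pn = inj₁ λ { s (s≤s s≤n) Ps → [ (λ s<n → none s s<n Ps) , (λ { refl → ¬Pn Ps }) ]′ (m≤n⇒m<n∨m≡n s≤n) }
... | inj₁ none                         = ⊥-elim (none n (n<1+n n) Pn)
... | inj₂ (t , s≤s t≤n , Pt , below) = t , t≤n , Pt , below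

-- Assume blocks X has an overlap of period p at i, while X and the stems of its
-- letters are overlap-free, and let `top` be the largest letter of the overlap, first
-- occurring at i + d0 with d0 < p.  Inside a stem, top would put the whole overlap
-- into that stem, whose neighbours in the block are larger.  At the start or middle
-- of a block of top, the period would force a third letter top into that block.  So
-- top ends a block at i + d0, and likewise at i + d0 + p; then the block boundaries of
-- the two periods are aligned and X itself has an overlap.
module OverlapInBlocks (X : Word) (X-free : OverlapFree′ X)
    (stems-free : ∀ k → k < length X → OverlapFree′ (stem (at X k)))
    (i p : ℕ) (p>0 : 0 < p) (fits : i + p + p < length (blocks X))
    (period : HasPeriodAt (blocks X) i p) where

  Z : Word
  Z = blocks X

  letter : ℕ → ℕ
  letter = at Z

  top : ℕ
  top = maxUpTo (λ d → letter (i + d)) (p + p)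

  ≤top : ∀ d → d ≤ p + p → letter (i + d) ≤ top
  ≤top = ≤maxUpTo (λ d → letter (i + d)) (p + p)

  top-in-first-period : ∃[ d ] (d < p × letter (i + d) ≡ top)
  top-in-first-period with maxUpTo-attained (λ d → letter (i + d)) (p + p)
  ... | s , s≤2p , ls≡top with <-cmp s p
  ...   | tri< s<p _ _ = s , s<p , ls≡top
  ...   | tri≈ _ refl _ = 0 , p>0 , trans (period 0 z≤n) (trans (cong (λ t → letter (t + p)) (+-identityʳ i)) ls≡top)
  ...   | tri> _ _ p<s with m≤n⇒∃[o]m+o≡n (<⇒≤ p<s)
  ...     | s′ , refl with m≤n⇒m<n∨m≡n (+-cancelˡ-≤ p _ _ s≤2p)
  ...       | inj₁ s′<p = s′ , s′<p , trans (period s′ (<⇒≤ s′<p)) (trans (cong letter (arith i s′ p)) ls≡top)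
    where
    arith : ∀ a b c → a + b + c ≡ a + (c + b)
    arith = solve-∀
  ...       | inj₂ refl = 0 , p>0 , trans (period 0 z≤n) (trans (cong (λ t → letter (t + p)) (+-identityʳ i))
                              (trans (period p ≤-refl) (trans (cong letter (+-assoc i p p)) ls≡top)))

  arith-suc : ∀ i d p → suc (i + (d + p)) ≡ i + suc d + p
  arith-suc = solve-∀

  first-top : ∃[ d ] (d < p × letter (i + d) ≡ top × (∀ s → s < d → ¬ letter (i + s) ≡ top))
  first-top with top-in-first-period
  ... | d , d<p , ld≡top with least-witness (λ s → letter (i + s) ≡ top) (λ s → letter (i + s) ≟ top) d ld≡top
  ...   | t , t≤d , lt≡top , below = t , ≤-<-trans t≤d d<p , lt≡top , below

  ¬>top-in-window : ∀ q → top < letter q → i ≤ q → q ≤ i + p + p → ⊥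
  ¬>top-in-window q top<lq i≤q q≤ with m≤n⇒∃[o]m+o≡n i≤q
  ... | e , refl = <⇒≱ top<lq (≤top e (+-cancelˡ-≤ i _ _ (subst (i + e ≤_) (+-assoc i p p) q≤)))

  window<length : ∀ q → q ≤ i + p + p → q < length Z
  window<length q q≤ = ≤-<-trans q≤ fits

  ¬window-copied : ∀ (W : Word) → OverlapFree′ W → ∀ r → r + p + p < length W →
    (∀ s → s ≤ p + p → at W (r + s) ≡ letter (i + s)) → ⊥
  ¬window-copied W W-free r fitsW copy = W-free r p (p>0 , fitsW , λ j j≤p →
    trans (copy j (≤-trans j≤p (m≤m+n p p)))
      (trans (period j j≤p) (trans (cong letter (+-assoc i j p))
        (trans (sym (copy (j + p) (+-monoˡ-≤ p j≤p))) (cong (at W) (sym (+-assoc r j p)))))))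

  letter-in-block : ∀ k o → k < length X → o < blockLen (at X k) → letter (blockStart X k + o) ≡ at (block (at X k)) o
  letter-in-block = at-blocks X

  data TopOccurrence (q : ℕ) : Set where
    atBlockStart : ∀ k → k < length X → at X k ≡ top → q ≡ blockStart X k → TopOccurrence q
    atBlockMiddle : ∀ k → k < length X → at X k ≡ top → q ≡ blockMiddle X k → TopOccurrence q
    atBlockLast : ∀ k → k < length X → suc (at X k) ≡ top → q ≡ blockLast X k → TopOccurrence q

  in-window : ∀ d → d ≤ p + p → i + d ≤ i + p + p
  in-window d d≤ = subst (i + d ≤_) (sym (+-assoc i p p)) (+-monoʳ-≤ i d≤)

  >top⇒beyond-window : ∀ y → top < letter y → i ≤ y → i + p + p < y
  >top⇒beyond-window y my i≤y with <-cmp (i + p + p) y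
  ... | tri< lt _ _ = lt
  ... | tri≈ _ e _ = ⊥-elim (¬>top-in-window y my i≤y (≤-reflexive (sym e)))
  ... | tri> _ _ gt = ⊥-elim (¬>top-in-window y my i≤y (<⇒≤ gt))

  ¬top-in-copy : ∀ (W : Word) → OverlapFree′ W → ∀ b d t → t < length W → i + d ≡ b + suc t → d ≤ p + p →
         top < letter b → top < letter (b + suc (length W)) →
         (∀ t' → t' < length W → letter (b + suc t') ≡ at W t') → ⊥
  ¬top-in-copy W W-free b d t t< eqd d≤ mb me copy with <-cmp b i
  ... | tri≈ _ refl _ = ¬>top-in-window b mb ≤-refl (≤-trans (m≤m+n b (p + p)) (≤-reflexive (sym (+-assoc b p p))))
  ... | tri> _ _ i<b = ¬>top-in-window b mb (<⇒≤ i<b) (≤-trans (≤-trans (m≤m+n b (suc t)) (≤-reflexive (sym eqd))) (in-window d d≤))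
  ... | tri< b<i _ _ with m≤n⇒∃[o]m+o≡n b<i
  ...   | r0 , ieq = ¬window-copied W W-free r0 bound eqW
    where
    n = length W
    big : i + p + p < b + suc n
    big = >top⇒beyond-window (b + suc n) me (≤-trans (≤-trans (m≤m+n i d) (≤-reflexive eqd)) (+-monoʳ-≤ b (s≤s (<⇒≤ t<))))
    ar1 : ∀ b r0 p n → suc b + r0 + p + p < b + suc n → suc b + (r0 + p + p) < suc b + n
    ar1 b r0 p n h = subst₂ _<_ (e1 b r0 p) (e2 b n) h
      where
      e1 : ∀ b r0 p → suc b + r0 + p + p ≡ suc b + (r0 + p + p)
      e1 = solve-∀
      e2 : ∀ b n → b + suc n ≡ suc b + n
      e2 = solve-∀
    bound : r0 + p + p < n
    bound = +-cancelˡ-< (suc b) _ _ (ar1 b r0 p n (subst (λ x → x + p + p < b + suc n) (sym ieq) big))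
    ar2 : ∀ b r0 s → b + suc (r0 + s) ≡ suc b + r0 + s
    ar2 = solve-∀
    eqW : ∀ s → s ≤ p + p → at W (r0 + s) ≡ letter (i + s)
    eqW s s≤ = trans (sym (copy (r0 + s) (≤-<-trans (≤-trans (+-monoʳ-≤ r0 s≤) (≤-reflexive (sym (+-assoc r0 p p)))) bound)))
                     (cong letter (trans (ar2 b r0 s) (cong (_+ s) ieq)))

  letter-blockStart : ∀ k → k < length X → letter (blockStart X k) ≡ at X k
  letter-blockStart k k<n = trans (cong letter (sym (+-identityʳ (blockStart X k)))) (letter-in-block k 0 k<n (0<blockLen (at X k)))

  letter-blockMiddle : ∀ k → k < length X → letter (blockMiddle X k) ≡ at X k
  letter-blockMiddle k k<n = trans (letter-in-block k _ k<n (halfLen<blockLen (at X k))) (block-at-half (at X k))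

  letter-blockLast : ∀ k → k < length X → letter (blockLast X k) ≡ suc (at X k)
  letter-blockLast k k<n = trans (letter-in-block k _ k<n (2halfLen<blockLen (at X k))) (block-at-end (at X k))

  topOccurrence : ∀ d → d ≤ p + p → letter (i + d) ≡ top → TopOccurrence (i + d)
  topOccurrence d d≤2p ld≡top with blocks-position X (i + d) (window<length (i + d) (in-window d d≤2p))
  ... | k , o , k<n , o<B , pos = classify (blockOffset a o o<B)
    where
    a = at X k

    inBlock : at (block a) o ≡ top
    inBlock = trans (sym (letter-in-block k o k<n o<B)) (trans (cong letter (sym pos)) ld≡top)

    top<a : ∀ r → r < length (stem a) → at (block a) o ≡ at (stem a) r → top < a
    top<a r r<n o≡r = subst (_< a) (trans (sym o≡r) inBlock) (stem-at-< a r r<n)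

    classify : BlockOffset a o → TopOccurrence (i + d)
    classify (atFirst refl)  = atBlockStart k k<n inBlock (trans pos (+-identityʳ _))
    classify (atMiddle refl) = atBlockMiddle k k<n (trans (sym (block-at-half a)) inBlock) pos
    classify (atLast refl)   = atBlockLast k k<n (trans (sym (block-at-end a)) inBlock) pos
    classify (inStem₁ r r<n refl) =
      ⊥-elim (¬top-in-copy (stem a) (stems-free k k<n) (blockStart X k) d r r<n pos d≤2p
        (subst (top <_) (sym (letter-blockStart k k<n)) top<a′)
        (subst (top <_) (sym (letter-blockMiddle k k<n)) top<a′)
        (λ t t<n → trans (letter-in-block k (suc t) k<n (<-trans (s≤s t<n) (halfLen<blockLen a))) (block-at-stem₁ a t t<n)))
      where top<a′ = top<a r r<n (block-at-stem₁ a r r<n)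
    classify (inStem₂ r r<n refl) =
      ⊥-elim (¬top-in-copy (stem a) (stems-free k k<n) (blockMiddle X k) d r r<n
        (trans pos (sym (+-assoc (blockStart X k) (halfLen a) (suc r)))) d≤2p
        (subst (top <_) (sym (letter-blockMiddle k k<n)) top<a′)
        (subst (top <_) (sym (trans (cong letter (+-assoc (blockStart X k) (halfLen a) (halfLen a))) (letter-blockLast k k<n)))
               (m<n⇒m<1+n top<a′))
        (λ t t<n → trans (cong letter (+-assoc (blockStart X k) (halfLen a) (suc t)))
          (trans (letter-in-block k (halfLen a + suc t) k<n
                    (<-trans (+-monoʳ-< (halfLen a) (s≤s t<n)) (2halfLen<blockLen a)))
                 (block-at-stem₂ a t t<n))))
      where top<a′ = top<a r r<n (block-at-stem₂ a r r<n)

  blockEnd-beyond-window : ∀ k → k < length X → at X k ≡ top → i ≤ blockLast X k →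
             i + p + p < blockLast X k
  blockEnd-beyond-window k k<n k≡top i≤ =
    >top⇒beyond-window _ (subst (_< letter _) k≡top (≤-reflexive (sym (letter-blockLast k k<n)))) i≤

  before-blockStart : ∀ k y → suc k < length X → suc y ≡ blockStart X (suc k) → y ≡ blockLast X k
  before-blockStart k y k< e = suc-injective (trans e (blockStart-suc≡suc-blockLast X k (<-trans (n<1+n k) k<)))

  before-blockStart-letter : ∀ k y → k < length X → suc y ≡ blockStart X k → ∃[ b ] (letter y ≡ suc b)
  before-blockStart-letter zero y _ ()
  before-blockStart-letter (suc k) y k<n e =
    at X k , trans (cong letter (before-blockStart k y k<n e)) (letter-blockLast k (<-trans (n<1+n k) k<n))

  letter-before-middle : ∀ k → k < length X → letter (blockStart X k + length (stem (at X k))) ≡ 0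
  letter-before-middle k k< = trans (letter-in-block k _ k< (<-trans (n<1+n _) (halfLen<blockLen (at X k)))) (block-at-half∸1 (at X k))


  -- With p the half length of the block of `top` starting at i + d: for d = 0 the
  -- overlap would end exactly at the last letter of the block; otherwise the letter
  -- at i + d - 1 ends the previous block (so is nonzero), while its copy p letters
  -- later is the last letter 0 of the first half of the block.
  ¬top-at-start-period-half : ∀ d k → d ≤ p → k < length X → i + d ≡ blockStart X k →
    p ≡ halfLen (at X k) → i + p + p < blockLast X k → ⊥
  ¬top-at-start-period-half zero k _ k<n i≡ p≡L beyond = <-irrefl ends-together beyond
    where
    ends-together : i + p + p ≡ blockLast X k
    ends-together = begin
      i + p + p                                  ≡⟨ +-assoc i p p ⟩
      i + (p + p)                                ≡⟨ cong₂ (λ x y → x + (y + y)) (trans (sym (+-identityʳ i)) i≡) p≡L ⟩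
      blockStart X k + (halfLen (at X k) + halfLen (at X k)) ∎
      where open ≡-Reasoning
  ¬top-at-start-period-half (suc d) k 1+d≤p k<n i+1+d≡ p≡L _
    with before-blockStart-letter k (i + d) k<n (trans (sym (+-suc i d)) i+1+d≡)
  ... | b , l≡1+b = 1+n≢0 (begin
    suc b                                       ≡⟨ l≡1+b ⟨
    letter (i + d)                              ≡⟨ period d (≤-trans (n≤1+n d) 1+d≤p) ⟩
    letter (i + d + p)                          ≡⟨ cong letter position ⟩
    letter (blockStart X k + length (stem a))   ≡⟨ letter-before-middle k k<n ⟩
    0 ∎)
    where
    open ≡-Reasoning
    a = at X k
    arith : ∀ i d n → i + d + suc n ≡ i + suc d + n
    arith = solve-∀
    position : i + d + p ≡ blockStart X k + length (stem a)
    position = trans (cong (i + d +_) p≡L) (trans (arith i d (length (stem a))) (cong (_+ length (stem a)) i+1+d≡))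

  ¬top-at-start : ∀ d k → d ≤ p → k < length X → at X k ≡ top → i + d ≡ blockStart X k → ⊥
  ¬top-at-start d k d≤p k<n a≡top i+d≡ with block-at≡⇒first⊎middle a p p<B repeated
    where
    a = at X k
    beyond : i + p + p < blockLast X k
    beyond = blockEnd-beyond-window k k<n a≡top (≤-trans (m≤m+n i d) (≤-trans (≤-reflexive i+d≡) (m≤m+n _ _)))
    p<B : p < blockLen a
    p<B = <-trans (+-cancelˡ-< (blockStart X k) _ _
            (subst (_< blockLast X k) (cong (_+ p) i+d≡) (≤-<-trans (+-monoˡ-≤ p (+-monoʳ-≤ i d≤p)) beyond)))
          (2halfLen<blockLen a)
    repeated : at (block a) p ≡ a
    repeated = trans (sym (letter-in-block k p k<n p<B))
      (trans (cong letter (sym (cong (_+ p) i+d≡)))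
        (trans (sym (period d d≤p)) (trans (cong letter i+d≡) (letter-blockStart k k<n))))
  ... | inj₁ refl = <-irrefl refl p>0
  ... | inj₂ p≡L  = ¬top-at-start-period-half d k d≤p k<n i+d≡ p≡L
                      (blockEnd-beyond-window k k<n a≡top (≤-trans (m≤m+n i d) (≤-trans (≤-reflexive i+d≡) (m≤m+n _ _))))

  ¬top-at-middle : ∀ d k → d < p → k < length X → at X k ≡ top → i + d ≡ blockMiddle X k → ⊥
  ¬top-at-middle d k d<p k<n a≡top i+d≡ with block-at≡⇒first⊎middle a (halfLen a + p) L+p<B repeated
    where
    a = at X k
    position : i + d + p ≡ blockStart X k + (halfLen a + p)
    position = trans (cong (_+ p) i+d≡) (+-assoc (blockStart X k) (halfLen a) p)
    beyond : i + p + p < blockLast X k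
    beyond = blockEnd-beyond-window k k<n a≡top
      (≤-trans (m≤m+n i d) (≤-trans (≤-reflexive i+d≡) (+-monoʳ-≤ (blockStart X k) (m≤m+n (halfLen a) (halfLen a)))))
    L+p<B : halfLen a + p < blockLen a
    L+p<B = <-trans (+-cancelˡ-< (blockStart X k) _ _
              (subst (_< blockLast X k) position (≤-<-trans (+-monoˡ-≤ p (+-monoʳ-≤ i (<⇒≤ d<p))) beyond)))
            (2halfLen<blockLen a)
    repeated : at (block a) (halfLen a + p) ≡ a
    repeated = trans (sym (letter-in-block k (halfLen a + p) k<n L+p<B))
      (trans (cong letter (sym position))
        (trans (sym (period d (<⇒≤ d<p))) (trans (cong letter i+d≡) (letter-blockMiddle k k<n))))
  ... | inj₁ ()
  ... | inj₂ L+p≡L = <-irrefl (sym (+-cancelˡ-≡ (halfLen (at X k)) p 0 (trans L+p≡L (sym (+-identityʳ _))))) p>0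

  period′ : ∀ q → i ≤ q → q ≤ i + p → letter q ≡ letter (q + p)
  period′ q i≤q q≤ with m≤n⇒∃[o]m+o≡n i≤q
  ... | t , refl = period t (+-cancelˡ-≤ i _ _ q≤)

  blockIndex<length : ∀ k q → q < length Z → blockStart X k ≡ q → k < length X
  blockIndex<length k q q< e with k <? length X
  ... | yes lt = lt
  ... | no nlt = ⊥-elim (<⇒≱ q< (subst₂ _≤_ (blockStart-length X) e (blockStart-mono-≤ X (≮⇒≥ nlt))))

  shifted<length : ∀ q → q ≤ i + p → q + p < length Z
  shifted<length q q≤ = ≤-<-trans (+-monoˡ-≤ p q≤) fits

  -- Blocks k1 and k1 + dd starting at i + e and i + e + p: walking through the
  -- period in both directions, every position q and its copy q + p sit at the same
  -- offset of two blocks k, k + dd with equal letters, so X has an overlap at k.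
  module Aligned (k1 dd : ℕ) (dd>0 : 0 < dd) (k1< : k1 < length X) (k2< : k1 + dd < length X) (e : ℕ) (e≤ : e ≤ p)
              (s1 : blockStart X k1 ≡ i + e) (s2 : blockStart X (k1 + dd) ≡ i + e + p) where

    Matched : ℕ → Set
    Matched q = ∃[ k ] ∃[ o ] (k < length X × k + dd < length X × o < blockLen (at X k) ×
                               q ≡ blockStart X k + o × q + p ≡ blockStart X (k + dd) + o × at X k ≡ at X (k + dd))

    i+e≤i+p : i + e ≤ i + p
    i+e≤i+p = +-monoʳ-≤ i e≤

    base : Matched (i + e)
    base = k1 , 0 , k1< , k2< , 0<blockLen (at X k1) , trans (sym s1) (sym (+-identityʳ _)) , trans (sym s2) (sym (+-identityʳ _)) ,
           trans (sym (letter-blockStart k1 k1<)) (trans (cong letter s1) (trans (period′ (i + e) (m≤m+n i e) i+e≤i+p) (trans (cong letter (sym s2)) (letter-blockStart (k1 + dd) k2<))))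

    matched-suc : ∀ q → i ≤ q → q < i + p → Matched q → Matched (suc q)
    matched-suc q i≤q q< (k , o , k< , kd< , o< , e1 , e2 , le) with suc o <? blockLen (at X k)
    ... | yes 1+o<B = k , suc o , k< , kd< , 1+o<B , trans (cong suc e1) (sym (+-suc _ o)) , trans (cong suc e2) (sym (+-suc _ o)) , le
    ... | no ¬1+o<B = suc k , 0 , 1+k<n , 1+k+dd<n , 0<blockLen (at X (suc k)) , trans 1+q≡ (sym (+-identityʳ _)) , trans 1+q+p≡ (sym (+-identityʳ _)) , same-letter
      where
      1+o≡B : suc o ≡ blockLen (at X k)
      1+o≡B = ≤-antisym o< (≮⇒≥ ¬1+o<B)
      1+q≡ : suc q ≡ blockStart X (suc k)
      1+q≡ = trans (cong suc e1) (trans (sym (+-suc _ o)) (trans (cong (blockStart X k +_) 1+o≡B) (sym (blockStart-suc X k k<))))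
      1+q+p≡ : suc q + p ≡ blockStart X (suc (k + dd))
      1+q+p≡ = trans (cong suc e2) (trans (sym (+-suc _ o)) (trans (cong (blockStart X (k + dd) +_) (trans 1+o≡B (cong blockLen le))) (sym (blockStart-suc X (k + dd) kd<))))
      1+k<n : suc k < length X
      1+k<n = blockIndex<length (suc k) (suc q) (≤-<-trans (≤-trans q< (m≤m+n (i + p) p)) fits) (sym 1+q≡)
      1+k+dd<n : suc k + dd < length X
      1+k+dd<n = blockIndex<length (suc (k + dd)) (suc q + p) (shifted<length (suc q) q<) (sym 1+q+p≡)
      same-letter : at X (suc k) ≡ at X (suc (k + dd))
      same-letter = trans (sym (letter-blockStart (suc k) 1+k<n)) (trans (cong letter (sym 1+q≡)) (trans (period′ (suc q) (≤-trans i≤q (n≤1+n q)) q<) (trans (cong letter 1+q+p≡) (letter-blockStart (suc (k + dd)) 1+k+dd<n))))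

    matched-pred : ∀ q → i ≤ q → q < i + p → Matched (suc q) → Matched q
    matched-pred q i≤q q< (k , suc o , k< , kd< , o< , e1 , e2 , le) =
      k , o , k< , kd< , <-trans (n<1+n o) o< , suc-injective (trans e1 (+-suc _ o)) , suc-injective (trans e2 (+-suc _ o)) , le
    matched-pred q i≤q q< (zero , zero , k< , kd< , o< , e1 , e2 , le) = ⊥-elim (1+n≢0 e1)
    matched-pred q i≤q q< (suc k , zero , k< , kd< , o< , e1 , e2 , le) = k , halfLen b + halfLen b , k<n′ , k+dd<n′ , 2halfLen<blockLen b , q≡ , q+p≡ , b≡b′
      where
      b = at X k
      b′ = at X (k + dd)
      k<n′ = <-trans (n<1+n k) k<
      k+dd<n′ = <-trans (n<1+n _) kd<
      q≡ : q ≡ blockStart X k + (halfLen b + halfLen b)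
      q≡ = before-blockStart k q k< (trans e1 (+-identityʳ _))
      q+p≡′ : q + p ≡ blockStart X (k + dd) + (halfLen b′ + halfLen b′)
      q+p≡′ = before-blockStart (k + dd) (q + p) kd< (trans e2 (+-identityʳ _))
      lq≡ : letter q ≡ suc b
      lq≡ = trans (cong letter q≡) (trans (letter-in-block k _ k<n′ (2halfLen<blockLen b)) (block-at-end b))
      lq+p≡ : letter (q + p) ≡ suc b′
      lq+p≡ = trans (cong letter q+p≡′) (trans (letter-in-block (k + dd) _ k+dd<n′ (2halfLen<blockLen b′)) (block-at-end b′))
      b≡b′ : b ≡ b′
      b≡b′ = suc-injective (trans (sym lq≡) (trans (period′ q i≤q (<⇒≤ q<)) lq+p≡))
      q+p≡ : q + p ≡ blockStart X (k + dd) + (halfLen b + halfLen b)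
      q+p≡ = trans q+p≡′ (cong (λ z → blockStart X (k + dd) + (halfLen z + halfLen z)) (sym b≡b′))

    matched-forward : ∀ n → e + n ≤ p → Matched (i + (e + n))
    matched-forward zero    _      = subst Matched (cong (i +_) (sym (+-identityʳ e))) base
    matched-forward (suc n) e+n<p = subst Matched (sym (trans (cong (i +_) (+-suc e n)) (+-suc i (e + n))))
      (matched-suc (i + (e + n)) (m≤m+n i _) (+-monoʳ-< i (subst (_≤ p) (+-suc e n) e+n<p))
           (matched-forward n (≤-trans (+-monoʳ-≤ e (n≤1+n n)) e+n<p)))

    matched-backward : ∀ n t → t + n ≡ e → Matched (i + t)
    matched-backward zero    t refl = subst (λ z → Matched (i + z)) (+-identityʳ t) base
    matched-backward (suc n) t t+n≡e = matched-pred (i + t) (m≤m+n i t) (+-monoʳ-< i t<p)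
      (subst Matched (+-suc i t) (matched-backward n (suc t) (trans (sym (+-suc t n)) t+n≡e)))
      where
      t<p : t < p
      t<p = <-≤-trans (subst (t <_) t+n≡e (m<m+n t (s≤s z≤n))) e≤

    matched : ∀ t → t ≤ p → Matched (i + t)
    matched t t≤p with ≤-total e t
    ... | inj₁ e≤t with m≤n⇒∃[o]m+o≡n e≤t
    ...   | n , refl = matched-forward n t≤p
    matched t t≤p | inj₂ t≤e with m≤n⇒∃[o]m+o≡n t≤e
    ...   | n , t+n≡e = matched-backward n t t+n≡e

    impossible : ⊥
    impossible with matched 0 z≤n | matched p ≤-refl
    ... | ka , oa , ka< , kad< , oa< , ea1 , ea2 , la | kb , ob , kb< , kbd< , ob< , eb1 , eb2 , lb = X-free ka dd (dd>0 , fitsX , periodX)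
      where
      oa<B′ : oa < blockLen (at X (ka + dd))
      oa<B′ = subst (λ z → oa < blockLen z) la oa<
      ka+dd≡kb : ka + dd ≡ kb
      ka+dd≡kb = blockStart-injective X kad< kb< oa<B′ ob< (trans (sym ea2) (trans (cong (_+ p) (+-identityʳ i)) eb1))
      fitsX : ka + dd + dd < length X
      fitsX = subst (λ z → z + dd < length X) (sym ka+dd≡kb) kbd<
      i≡ : i ≡ blockStart X ka + oa
      i≡ = trans (sym (+-identityʳ i)) ea1
      periodX : ∀ j → j ≤ dd → at X (ka + j) ≡ at X (ka + j + dd)
      periodX zero _ = subst (λ z → at X z ≡ at X (z + dd)) (sym (+-identityʳ ka)) la
      periodX (suc j) sj≤ with m≤n⇒∃[o]m+o≡n i≤start
        where
        kk = ka + suc j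
        i≤start : i ≤ blockStart X kk
        i≤start = ≤-trans (≤-reflexive i≡) (≤-trans (<⇒≤ (+-monoʳ-< (blockStart X ka) oa<)) (blockEnd≤blockStart X (subst (ka <_) (sym (+-suc ka j)) (s≤s (m≤m+n ka j))) ka<))
      ... | t , teq with matched t (+-cancelˡ-≤ i _ _ (subst (_≤ i + p) (sym teq) start≤))
        where
        kk = ka + suc j
        start≤ : blockStart X kk ≤ i + p
        start≤ = ≤-trans (blockStart-mono-≤ X (subst (kk ≤_) ka+dd≡kb (+-monoʳ-≤ ka sj≤))) (≤-trans (m≤m+n (blockStart X kb) ob) (≤-reflexive (sym eb1)))
      ... | k , o , k< , kd< , o< , e1 , e2 , le = subst (λ z → at X z ≡ at X (z + dd)) k≡kk le
        where
        kk = ka + suc j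
        kk<n : kk < length X
        kk<n = ≤-<-trans (subst (kk ≤_) ka+dd≡kb (+-monoʳ-≤ ka sj≤)) kb<
        k≡kk : k ≡ kk
        k≡kk = blockStart-injective X k< kk<n o< (0<blockLen (at X kk)) (trans (sym e1) (trans teq (sym (+-identityʳ _))))

  letter-before-end : ∀ k d′ → k < length X → i + suc d′ ≡ blockLast X k → letter (i + d′) ≡ 0
  letter-before-end k d′ k<n eq = trans (cong letter position) (trans (letter-in-block k _ k<n (<-trans (+-monoʳ-< (halfLen a) (n<1+n _)) (2halfLen<blockLen a))) (block-at-end∸1 a))
    where
    a = at X k
    position : i + d′ ≡ blockStart X k + (halfLen a + length (stem a))
    position = suc-injective (trans (sym (+-suc i d′)) (trans eq (trans (cong (blockStart X k +_) (+-suc (halfLen a) _)) (+-suc (blockStart X k) _))))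

  ¬end-then-start : ∀ d0 k0 k′ → d0 < p → k0 < length X → k′ < length X → i + d0 ≡ blockLast X k0 →
           at X k′ ≡ top → i + (d0 + p) ≡ blockStart X k′ → ⊥
  ¬end-then-start zero k0 k′ d0<p k0<n k′<n i+d0≡ a′≡top i+d0+p≡ = ¬top-at-start p k′ ≤-refl k′<n a′≡top i+d0+p≡
  ¬end-then-start (suc d′) k0 k′ d0<p k0<n k′<n i+d0≡ a′≡top i+d0+p≡ with before-blockStart-letter k′ (i + d′ + p) k′<n (trans (cong suc (+-assoc i d′ p)) (trans (sym (+-suc i (d′ + p))) i+d0+p≡))
  ... | b , lb≡ = 1+n≢0 (trans (sym lb≡) (trans (sym (period d′ (≤-trans (n≤1+n d′) (<⇒≤ d0<p)))) (letter-before-end k0 d′ k0<n i+d0≡)))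

  -- Block k′ starts strictly between i + d0 and i + d0 + p, so its first letter top
  -- either lies in the first period or copies an occurrence of top before i + d0.
  ¬end-then-middle : ∀ d0 k0 k′ → d0 < p → (∀ s → s < d0 → ¬ (letter (i + s) ≡ top)) → k0 < length X → k′ < length X →
           suc (at X k0) ≡ top → i + d0 ≡ blockLast X k0 →
           at X k′ ≡ top → i + (d0 + p) ≡ blockMiddle X k′ → ⊥
  ¬end-then-middle d0 k0 k′ d0<p before-first k0<n k′<n 1+a₀≡top i+d0≡ a′≡top i+d0+p≡ with <-cmp k0 k′
  ... | tri≈ _ refl _ = 1+n≢n (trans 1+a₀≡top (sym a′≡top))
  ... | tri> _ _ k′<k0 = <⇒≱ (subst (i + d0 <_) (+-assoc i d0 p) (m<m+n (i + d0) p>0)) (≤-trans (≤-reflexive i+d0+p≡) (≤-trans (+-monoʳ-≤ (blockStart X k′) (<⇒≤ (halfLen<blockLen (at X k′)))) (≤-trans (blockEnd≤blockStart X k′<k0 k′<n) (≤-trans (m≤m+n (blockStart X k0) _) (≤-reflexive (sym i+d0≡))))))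
  ... | tri< k0<k′ _ _ = finish
    where
    a0 = at X k0
    a′ = at X k′
    after-k0 : suc (i + d0) ≤ blockStart X k′
    after-k0 = subst (_≤ blockStart X k′) (trans (blockStart-suc≡suc-blockLast X k0 k0<n) (cong suc (sym i+d0≡))) (blockStart-mono-≤ X k0<k′)
    before-d0+p : blockStart X k′ < i + (d0 + p)
    before-d0+p = subst (blockStart X k′ <_) (sym i+d0+p≡) (m<m+n (blockStart X k′) (s≤s z≤n))
    top-at-k′ : letter (blockStart X k′) ≡ top
    top-at-k′ = trans (letter-blockStart k′ k′<n) a′≡top
    finish : ⊥
    finish with m≤n⇒∃[o]m+o≡n (≤-trans (m≤m+n i (suc d0)) (subst (_≤ blockStart X k′) (sym (+-suc i d0)) after-k0))
    ... | d1 , e1 with d1 ≤? p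
    ...   | yes d1≤p = ¬top-at-start d1 k′ d1≤p k′<n a′≡top e1
    ...   | no d1≰p with m≤n⇒∃[o]m+o≡n (<⇒≤ (≰⇒> d1≰p))
    ...     | d2 , e2 = before-first d2 d2<d0 (trans (period d2 d2≤p) (trans (cong letter position) top-at-k′))
      where
      d1<  : d1 < d0 + p
      d1< = +-cancelˡ-< i _ _ (subst (_< i + (d0 + p)) (sym e1) before-d0+p)
      d2<d0 : d2 < d0
      d2<d0 = +-cancelˡ-< p _ _ (subst₂ _<_ (sym e2) (+-comm d0 p) d1<)
      d2≤p : d2 ≤ p
      d2≤p = ≤-trans (<⇒≤ d2<d0) (<⇒≤ d0<p)
      arith : ∀ i d2 p → i + d2 + p ≡ i + (p + d2)
      arith = solve-∀
      position : i + d2 + p ≡ blockStart X k′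
      position = trans (arith i d2 p) (trans (cong (i +_) e2) e1)

  ¬end-then-end : ∀ d0 k0 k1 → d0 < p → k0 < length X → k1 < length X →
           i + d0 ≡ blockLast X k0 →
           i + (d0 + p) ≡ blockLast X k1 → ⊥
  ¬end-then-end d0 k0 k1 d0<p k0<n k1<n i+d0≡ i+d0+p≡′ = go
    where
    s1 : blockStart X (suc k0) ≡ suc (i + d0)
    s1 = trans (blockStart-suc≡suc-blockLast X k0 k0<n) (cong suc (sym i+d0≡))
    s2 : blockStart X (suc k1) ≡ suc (i + (d0 + p))
    s2 = trans (blockStart-suc≡suc-blockLast X k1 k1<n) (cong suc (sym i+d0+p≡′))
    i+d0<i+d0+p : suc (i + d0) < suc (i + (d0 + p))
    i+d0<i+d0+p = s≤s (subst (i + d0 <_) (+-assoc i d0 p) (m<m+n (i + d0) p>0))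
    1+k0<1+k1 : suc k0 < suc k1
    1+k0<1+k1 with suc k0 <? suc k1
    ... | yes q = q
    ... | no nq = ⊥-elim (<⇒≱ i+d0<i+d0+p (subst₂ _≤_ s2 s1 (blockStart-mono-≤ X (≮⇒≥ nq))))
    1+k1<n : suc k1 < length X
    1+k1<n = blockIndex<length (suc k1) _ (≤-<-trans (subst (_≤ i + p + p) (sym (arith-suc i d0 p)) (+-monoˡ-≤ p (+-monoʳ-≤ i d0<p))) fits) s2
    1+k0<n : suc k0 < length X
    1+k0<n = <-trans 1+k0<1+k1 1+k1<n
    go : ⊥
    go with m≤n⇒∃[o]m+o≡n 1+k0<1+k1
    ... | dd′ , kk = Aligned.impossible (suc k0) (suc dd′) (s≤s z≤n) 1+k0<n (subst (_< length X) 1+k1≡ 1+k1<n) (suc d0) d0<p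
                        (trans s1 (sym (+-suc i d0))) (trans (cong (blockStart X) (sym 1+k1≡)) (trans s2 (arith-suc i d0 p)))
      where
      1+k1≡ : suc k1 ≡ suc k0 + suc dd′
      1+k1≡ = trans (sym kk) (sym (+-suc (suc k0) dd′))

  impossible : ⊥
  impossible with first-top
  ... | d0 , d0<p , top-at-d0 , before-first with topOccurrence d0 (≤-trans (<⇒≤ d0<p) (m≤m+n p p)) top-at-d0
  ...   | atBlockStart k k<n a′≡top eq = ¬top-at-start d0 k (<⇒≤ d0<p) k<n a′≡top eq
  ...   | atBlockMiddle k k<n a′≡top eq = ¬top-at-middle d0 k d0<p k<n a′≡top eq
  ...   | atBlockLast k0 k0<n 1+a₀≡top i+d0≡ with topOccurrence (d0 + p) (+-monoˡ-≤ p (<⇒≤ d0<p)) top-at-d0+p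
    where
    top-at-d0+p : letter (i + (d0 + p)) ≡ top
    top-at-d0+p = trans (cong letter (sym (+-assoc i d0 p))) (trans (sym (period d0 (<⇒≤ d0<p))) top-at-d0)
  ...     | atBlockStart k′ k′<n a′≡top i+d0+p≡ = ¬end-then-start d0 k0 k′ d0<p k0<n k′<n i+d0≡ a′≡top i+d0+p≡
  ...     | atBlockMiddle k′ k′<n a′≡top i+d0+p≡ = ¬end-then-middle d0 k0 k′ d0<p before-first k0<n k′<n 1+a₀≡top i+d0≡ a′≡top i+d0+p≡
  ...     | atBlockLast k1 k1<n _ i+d0+p≡′ = ¬end-then-end d0 k0 k1 d0<p k0<n k1<n i+d0≡ i+d0+p≡′

blocks-overlapFree′ : ∀ X → OverlapFree′ X → (∀ k → k < length X → OverlapFree′ (stem (at X k))) →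
  OverlapFree′ (blocks X)
blocks-overlapFree′ X X-free stems-free i p (p>0 , fits , period) =
  OverlapInBlocks.impossible X X-free stems-free i p p>0 fits period



stem⁺ : ℕ → Word
stem⁺ a = stem a ++ [ a ]

blocks-stem⁺ : ∀ a → blocks (stem⁺ a) ≡ stem⁺ (suc a)
blocks-stem⁺ a = begin
  blocks (stem a ++ [ a ])                              ≡⟨ concatMap-++ block (stem a) [ a ] ⟩
  blocks (stem a) ++ block a ++ []                      ≡⟨ cong (blocks (stem a) ++_) (++-identityʳ (block a)) ⟩
  blocks (stem a) ++ block a                            ≡⟨ cong (_++ block a) (φ≡blocks (stem a)) ⟨
  φ (stem a) ++ (a ∷ stem a ++ a ∷ stem a ++ [ suc a ]) ≡⟨ solve 4 (λ F A U S → F ⊕ (A ⊕ U ⊕ A ⊕ U ⊕ S) ⊜ (F ⊕ A ⊕ U ⊕ A ⊕ U) ⊕ S)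
                                                               refl (φ (stem a)) [ a ] (stem a) [ suc a ] ⟩
  (φ (stem a) ++ a ∷ stem a ++ a ∷ stem a) ++ [ suc a ] ∎
  where open ≡-Reasoning

[_]-overlapFree′ : ∀ c → OverlapFree′ [ c ]
[ c ]-overlapFree′ i p (p>0 , fits , _) = <⇒≱ fits (≤-trans p>0 (m≤n+m p (i + p)))

stem⁺-≤ : ∀ a → All (_≤ a) (stem⁺ a)
stem⁺-≤ a = ++⁺ (All.map <⇒≤ (stem-< a)) (≤-refl ∷ [])

stem⁺-overlapFree′ : ∀ a → OverlapFree′ (stem⁺ a)
stem⁺-overlapFree′ = <-rec (λ a → OverlapFree′ (stem⁺ a)) step
  where
  step : ∀ a → (∀ {b} → b < a → OverlapFree′ (stem⁺ b)) → OverlapFree′ (stem⁺ a)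
  step zero    _   = [ 0 ]-overlapFree′
  step (suc a) rec = subst OverlapFree′ (blocks-stem⁺ a)
    (blocks-overlapFree′ (stem⁺ a) (rec (n<1+n a)) λ k k<n →
      overlapFree′-prefix (stem (at (stem⁺ a) k)) _ (rec (s≤s (All-at (stem⁺-≤ a) k k<n))))

stem-overlapFree′ : ∀ a → OverlapFree′ (stem a)
stem-overlapFree′ a = overlapFree′-prefix (stem a) [ a ] (stem⁺-overlapFree′ a)

iterφ-overlapFree′ : ∀ n h → OverlapFree′ (iter n φ [ h ])
iterφ-overlapFree′ zero    h = [ h ]-overlapFree′
iterφ-overlapFree′ (suc n) h = subst OverlapFree′ (sym (φ≡blocks (iter n φ [ h ])))
  (blocks-overlapFree′ (iter n φ [ h ]) (iterφ-overlapFree′ n h) (λ k _ → stem-overlapFree′ (at (iter n φ [ h ]) k)))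

-- Lexicographic minimality

EndsWithSquare : ℕ → Word → Set
EndsWithSquare c P = ∃[ Q ] ∃[ x ] (P ≡ Q ++ c ∷ x ++ c ∷ x)

-- Every letter d of a greedy word, except the first, is forced: following the
-- preceding prefix P with any smaller letter c would complete an overlap c x c x c.
Greedy : Word → Set
Greedy W = ∀ P d R → W ≡ P ++ d ∷ R → ¬ P ≡ [] → ∀ c → c < d → EndsWithSquare c P

endsWithSquare-++ˡ : ∀ c R P → EndsWithSquare c P → EndsWithSquare c (R ++ P)
endsWithSquare-++ˡ c R P (Q , x , refl) = R ++ Q , x , sym (++-assoc R Q _)

endsWithSquare-blocks : ∀ c P → EndsWithSquare c P → EndsWithSquare c (blocks P)
endsWithSquare-blocks c P (Q , x , refl) = blocks Q , (T ++ blocks x) , (begin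
  blocks (Q ++ c ∷ x ++ c ∷ x)                           ≡⟨ concatMap-++ block Q _ ⟩
  blocks Q ++ block c ++ blocks (x ++ c ∷ x)             ≡⟨ cong (λ z → blocks Q ++ block c ++ z) (concatMap-++ block x _) ⟩
  blocks Q ++ block c ++ blocks x ++ block c ++ blocks x ≡⟨ solve 4 (λ A C T B → A ⊕ (C ⊕ T) ⊕ B ⊕ (C ⊕ T) ⊕ B ⊜ A ⊕ C ⊕ (T ⊕ B) ⊕ C ⊕ (T ⊕ B))
                                                              refl (blocks Q) [ c ] T (blocks x) ⟩
  blocks Q ++ c ∷ (T ++ blocks x) ++ c ∷ (T ++ blocks x) ∎)
  where
  open ≡-Reasoning
  T = stem c ++ c ∷ stem c ++ [ suc c ]

endsWithSquare⇒¬overlapFree : ∀ c P v → EndsWithSquare c P → ¬ OverlapFree (P ++ c ∷ v)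
endsWithSquare⇒¬overlapFree c P v (Q , x , refl) noOverlap =
  noOverlap (c ∷ x ++ c ∷ x ++ [ c ] , (c , x , refl) , (Q , v , reassoc))
  where
  reassoc : (Q ++ c ∷ x ++ c ∷ x) ++ c ∷ v ≡ Q ++ (c ∷ x ++ c ∷ x ++ [ c ]) ++ v
  reassoc = solve 4 (λ Q C X V → (Q ⊕ C ⊕ X ⊕ C ⊕ X) ⊕ C ⊕ V ⊜ Q ⊕ (C ⊕ X ⊕ C ⊕ X ⊕ C) ⊕ V) refl Q [ c ] x v

++-∷≢[] : ∀ (A : Word) b B → ¬ A ++ b ∷ B ≡ []
++-∷≢[] A b B eq with ++-conicalʳ A (b ∷ B) eq
... | ()

++-split : ∀ (A B P : Word) d R → A ++ B ≡ P ++ d ∷ R →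
  (∃[ r ] (A ≡ P ++ d ∷ r)) ⊎ (∃[ P′ ] (P ≡ A ++ P′ × B ≡ P′ ++ d ∷ R))
++-split []      B P       d R eq = inj₂ (P , refl , eq)
++-split (a ∷ A) B []      d R eq = inj₁ (A , cong (_∷ A) (∷-injectiveˡ eq))
++-split (a ∷ A) B (x ∷ P) d R eq with ++-split A B P d R (∷-injectiveʳ eq)
... | inj₁ (r , A≡) = inj₁ (r , cong₂ _∷_ (∷-injectiveˡ eq) A≡)
... | inj₂ (P′ , P≡ , B≡) = inj₂ (P′ , cong₂ _∷_ (sym (∷-injectiveˡ eq)) P≡ , B≡)

blocks-split : ∀ X P d R → blocks X ≡ P ++ d ∷ R →
  ∃[ X₁ ] ∃[ a ] ∃[ X₂ ] ∃[ q ] ∃[ r ] (X ≡ X₁ ++ a ∷ X₂ × block a ≡ q ++ d ∷ r × P ≡ blocks X₁ ++ q)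
blocks-split []       P d R eq = ⊥-elim (++-∷≢[] P d R (sym eq))
blocks-split (x ∷ xs) P d R eq with ++-split (block x) (blocks xs) P d R eq
... | inj₁ (r , e) = [] , x , xs , P , r , refl , e , refl
... | inj₂ (P′ , P≡ , e) with blocks-split xs P′ d R e
...   | X₁ , a , X₂ , q , r , xs≡ , block≡ , P′≡ = x ∷ X₁ , a , X₂ , q , r , cong (x ∷_) xs≡ , block≡ ,
          trans P≡ (trans (cong (block x ++_) P′≡) (sym (++-assoc (block x) (blocks X₁) q)))

stem≡[]⇒0 : ∀ a → stem a ≡ [] → a ≡ 0
stem≡[]⇒0 zero    _  = refl
stem≡[]⇒0 (suc a) eq = ⊥-elim (++-∷≢[] (φ (stem a)) a _ eq)

stem-starts-with-0 : ∀ a → stem a ≡ [] ⊎ ∃[ t ] (stem a ≡ 0 ∷ t)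
stem-starts-with-0 zero = inj₁ refl
stem-starts-with-0 (suc a) with stem-starts-with-0 a
... | inj₁ eq       rewrite eq | stem≡[]⇒0 a eq   = inj₂ (_ , refl)
... | inj₂ (t , eq) rewrite eq | φ-letter≡block 0 = inj₂ (_ , refl)

stem∷stem-starts-with-0 : ∀ a → ∃[ r ] (stem a ++ a ∷ stem a ≡ 0 ∷ r)
stem∷stem-starts-with-0 a with stem-starts-with-0 a
... | inj₁ eq       rewrite eq | stem≡[]⇒0 a eq = _ , refl
... | inj₂ (t , eq) rewrite eq                  = _ , refl

stemSquare-assoc : ∀ a → stemSquare a ≡ (stem a ++ a ∷ stem a) ++ [ a ]
stemSquare-assoc a = sym (++-assoc (stem a) (a ∷ stem a) [ a ])

greedy-inside-block : ∀ a c d (P q r : Word) → Greedy (stemSquare a) →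
  stem a ++ a ∷ stem a ≡ q ++ d ∷ r → c < d → EndsWithSquare c (P ++ q)
greedy-inside-block a c d P [] r greedy eq c<d with stem∷stem-starts-with-0 a
... | _ , eq₀ = ⊥-elim (n≮0 (subst (c <_) (∷-injectiveˡ (trans (sym eq) eq₀)) c<d))
greedy-inside-block a c d P (y ∷ q) r greedy eq c<d =
  endsWithSquare-++ˡ c P _ (greedy (y ∷ q) d (r ++ [ a ]) split (λ ()) c c<d)
  where
  split : stemSquare a ≡ (y ∷ q) ++ d ∷ (r ++ [ a ])
  split = trans (stemSquare-assoc a) (trans (cong (_++ [ a ]) eq) (++-assoc (y ∷ q) (d ∷ r) [ a ]))

greedy-at-block-end : ∀ a c (P : Word) → Greedy (stemSquare a) → c < suc a →
  EndsWithSquare c (P ++ a ∷ stem a ++ a ∷ stem a)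
greedy-at-block-end a c P greedy c<1+a with m≤n⇒m<n∨m≡n (≤-pred c<1+a)
... | inj₂ refl = P , stem c , refl
... | inj₁ c<a  = subst (EndsWithSquare c) (++-assoc P [ a ] _)
  (endsWithSquare-++ˡ c (P ++ [ a ]) _
    (greedy (stem a ++ a ∷ stem a) a [] (stemSquare-assoc a) (++-∷≢[] (stem a) a (stem a)) c c<a))

All-∈-++ : ∀ {P : ℕ → Set} X₁ a X₂ → All P (X₁ ++ a ∷ X₂) → P a
All-∈-++ X₁ a X₂ all with ++⁻ʳ X₁ all
... | Pa ∷ _ = Pa

greedy-blocks : ∀ X → Greedy X → All (λ b → Greedy (stemSquare b)) X → Greedy (blocks X)
greedy-blocks X greedyX greedyStems P d R eq P≢[] c c<d with blocks-split X P d R eq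
... | X₁ , a , X₂ , [] , r , X≡ , block≡ , P≡ =
  subst (EndsWithSquare c) (sym (trans P≡ (++-identityʳ (blocks X₁))))
    (endsWithSquare-blocks c X₁ (greedyX X₁ a X₂ X≡ X₁≢[] c (subst (c <_) (sym (∷-injectiveˡ block≡)) c<d)))
  where
  X₁≢[] : ¬ X₁ ≡ []
  X₁≢[] refl = P≢[] (trans P≡ refl)
... | X₁ , a , X₂ , a′ ∷ q , r , X≡ , block≡ , P≡
  with ++-split (stem a ++ a ∷ stem a) [ suc a ] q d r
         (trans (++-assoc (stem a) (a ∷ stem a) [ suc a ]) (∷-injectiveʳ block≡))
...   | inj₁ (r′ , inside) = subst (EndsWithSquare c) (sym P≡′)
          (greedy-inside-block a c d (blocks X₁ ++ [ a ]) q r′ greedyA inside c<d)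
  where
  greedyA = All-∈-++ X₁ a X₂ (subst (All _) X≡ greedyStems)
  P≡′ : P ≡ (blocks X₁ ++ [ a ]) ++ q
  P≡′ = trans P≡ (trans (cong (λ z → blocks X₁ ++ z ∷ q) (sym (∷-injectiveˡ block≡))) (sym (++-assoc (blocks X₁) [ a ] q)))
...   | inj₂ ([] , q≡ , last≡) = subst (EndsWithSquare c) (sym P≡′)
          (greedy-at-block-end a c (blocks X₁) greedyA (subst (c <_) (sym (∷-injectiveˡ last≡)) c<d))
  where
  greedyA = All-∈-++ X₁ a X₂ (subst (All _) X≡ greedyStems)
  P≡′ : P ≡ blocks X₁ ++ a ∷ stem a ++ a ∷ stem a
  P≡′ = trans P≡ (cong₂ (λ z w → blocks X₁ ++ z ∷ w) (sym (∷-injectiveˡ block≡)) (trans q≡ (++-identityʳ _)))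
...   | inj₂ (_ ∷ P′ , _ , last≡) = ⊥-elim (++-∷≢[] P′ d r (sym (∷-injectiveʳ last≡)))

[_]-greedy : ∀ h → Greedy [ h ]
[ h ]-greedy []      d R eq P≢[] = ⊥-elim (P≢[] refl)
[ h ]-greedy (_ ∷ P) d R eq _    = ⊥-elim (++-∷≢[] P d R (sym (∷-injectiveʳ eq)))

stemSquare-greedy : ∀ a → Greedy (stemSquare a)
stemSquare-greedy = <-rec (λ a → Greedy (stemSquare a)) step
  where
  step : ∀ a → (∀ {b} → b < a → Greedy (stemSquare b)) → Greedy (stemSquare a)
  step zero    _   []              d R eq P≢[] = ⊥-elim (P≢[] refl)
  step zero    _   (_ ∷ [])        d R eq _    c c<d =
    ⊥-elim (n≮0 (subst (c <_) (sym (∷-injectiveˡ (∷-injectiveʳ eq))) c<d))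
  step zero    _   (_ ∷ _ ∷ P)     d R eq _    =
    ⊥-elim (++-∷≢[] P d R (sym (∷-injectiveʳ (∷-injectiveʳ eq))))
  step (suc a) rec = subst Greedy (blocks-stemSquare≡stemSquare-suc a (φ≡blocks (stem a)))
    (greedy-blocks (stemSquare a) (rec (n<1+n a)) (All.map (λ b<1+a → rec b<1+a) (stemSquare-< a (stem-< a))))

iterφ-greedy : ∀ n h → Greedy (iter n φ [ h ])
iterφ-greedy zero    h = [ h ]-greedy
iterφ-greedy (suc n) h = subst Greedy (sym (φ≡blocks (iter n φ [ h ])))
  (greedy-blocks _ (iterφ-greedy n h) (All.tabulate (λ {b} _ → stemSquare-greedy b)))

compare : ∀ (w v : Word) →
  ∃[ z ] (v ≡ w ++ z) ⊎ ∃[ z₀ ] ∃[ z ] (w ≡ v ++ z₀ ∷ z) ⊎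
  ∃[ P ] ∃[ d ] ∃[ c ] ∃[ w′ ] ∃[ v′ ] (c ≢ d × w ≡ P ++ d ∷ w′ × v ≡ P ++ c ∷ v′)
compare []      v       = inj₁ (v , refl)
compare (x ∷ w) []      = inj₂ (inj₁ (x , w , refl))
compare (x ∷ w) (y ∷ v) with x ≟ y
... | no x≢y = inj₂ (inj₂ ([] , x , y , w , v , (λ y≡x → x≢y (sym y≡x)) , refl , refl))
... | yes refl with compare w v
...   | inj₁ (z , v≡) = inj₁ (z , cong (x ∷_) v≡)
...   | inj₂ (inj₁ (z₀ , z , w≡)) = inj₂ (inj₁ (z₀ , z , cong (x ∷_) w≡))
...   | inj₂ (inj₂ (P , d , c , w′ , v′ , c≢d , w≡ , v≡)) =
  inj₂ (inj₂ (x ∷ P , d , c , w′ , v′ , c≢d , cong (x ∷_) w≡ , cong (x ∷_) v≡))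

¬∷ʳ-max≡prefix : ∀ (T t : Word) k z₀ z → All (_< k) T → ¬ T ++ [ k ] ≡ t ++ k ∷ z₀ ∷ z
¬∷ʳ-max≡prefix []      []      k z₀ z _           eq with ∷-injectiveʳ eq
... | ()
¬∷ʳ-max≡prefix []      (_ ∷ t) k z₀ z _           eq = ++-∷≢[] t k _ (sym (∷-injectiveʳ eq))
¬∷ʳ-max≡prefix (x ∷ T) []      k z₀ z (x<k ∷ _)   eq = <-irrefl (∷-injectiveˡ eq) x<k
¬∷ʳ-max≡prefix (x ∷ T) (_ ∷ t) k z₀ z (_ ∷ T<k)   eq = ¬∷ʳ-max≡prefix T t k z₀ z T<k (∷-injectiveʳ eq)

greedy⇒lexLeast : ∀ {h k} W T → Greedy W → StartsWith h W → W ≡ T ++ [ k ] → All (_< k) T →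
  ∀ v → OFFromTo h k v → W ≤lex v
greedy⇒lexLeast {h} {k} W T greedy (t , W≡h∷t) W≡T∷ʳk T<k v (v-free , (_ , v≡h∷_) , (s , v≡s∷ʳk))
  with compare W v
... | inj₁ v-extends-W = inj₁ v-extends-W
... | inj₂ (inj₁ (z₀ , z , W≡)) = ⊥-elim (¬∷ʳ-max≡prefix T s k z₀ z T<k (begin
  T ++ [ k ]              ≡⟨ W≡T∷ʳk ⟨
  W                       ≡⟨ W≡ ⟩
  v ++ z₀ ∷ z             ≡⟨ cong (_++ z₀ ∷ z) v≡s∷ʳk ⟩
  (s ++ [ k ]) ++ z₀ ∷ z  ≡⟨ ++-assoc s [ k ] _ ⟩
  s ++ k ∷ z₀ ∷ z         ∎))
  where open ≡-Reasoning
... | inj₂ (inj₂ (P , d , c , w′ , v′ , c≢d , W≡ , v≡)) with <-cmp c d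
...   | tri> _ _ d<c = inj₂ (P , d , c , w′ , v′ , d<c , W≡ , v≡)
...   | tri≈ _ c≡d _ = ⊥-elim (c≢d c≡d)
...   | tri< c<d _ _ = ⊥-elim (endsWithSquare⇒¬overlapFree c P v′
                               (greedy P d w′ W≡ P≢[] c c<d) (subst OverlapFree v≡ v-free))
  where
  P≢[] : ¬ P ≡ []
  P≢[] refl = c≢d (trans (∷-injectiveˡ (trans (sym v≡) v≡h∷_)) (sym (∷-injectiveˡ (trans (sym W≡) W≡h∷t))))

iterφ-starts : ∀ n h → StartsWith h (iter n φ [ h ])
iterφ-starts zero    h = [] , refl
iterφ-starts (suc n) h with iterφ-starts n h
... | t , eq rewrite eq | φ-letter≡block h = _ , refl

iterφ-ends : ∀ n h → ∃[ T ] (iter n φ [ h ] ≡ T ++ [ h + n ] × All (_< h + n) T)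
iterφ-ends zero    h = [] , cong [_] (sym (+-identityʳ h)) , []
iterφ-ends (suc n) h with iterφ-ends n h
... | T , eq , T<a = T′ , eq′ , subst (λ z → All (_< z) T′) (sym (+-suc h n)) T′<1+a
  where
  a  = h + n
  T′ = blocks T ++ a ∷ stem a ++ a ∷ stem a

  eq′ : iter (suc n) φ [ h ] ≡ T′ ++ [ h + suc n ]
  eq′ = begin
    φ (iter n φ [ h ])        ≡⟨ cong φ eq ⟩
    φ (T ++ [ a ])            ≡⟨ φ≡blocks (T ++ [ a ]) ⟩
    blocks (T ++ [ a ])       ≡⟨ concatMap-++ block T [ a ] ⟩
    blocks T ++ block a ++ [] ≡⟨ solve 4 (λ C A U S → C ⊕ (A ⊕ U ⊕ A ⊕ U ⊕ S) ⊕ id ⊜ (C ⊕ A ⊕ U ⊕ A ⊕ U) ⊕ S)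
                                       refl (blocks T) [ a ] (stem a) [ suc a ] ⟩
    T′ ++ [ suc a ]           ≡⟨ cong (λ z → T′ ++ [ z ]) (+-suc h n) ⟨
    T′ ++ [ h + suc n ]       ∎
    where open ≡-Reasoning

  stem<1+a : All (_< suc a) (stem a)
  stem<1+a = All<-weaken (n≤1+n a) (stem-< a)

  T′<1+a : All (_< suc a) T′
  T′<1+a = ++⁺ (blocks-< a T<a) (n<1+n a ∷ ++⁺ stem<1+a (n<1+n a ∷ stem<1+a))

corollary9 : ∀ (h k : ℕ) → h ≤ k →
    IsLexLeast (OFFromTo h k) (iter (k ∸ h) φ [ h ])
corollary9 h k h≤k with iterφ-ends (k ∸ h) h
... | T , W≡ , T< rewrite m+[n∸m]≡n h≤k =
  (overlapFree′⇒overlapFree W (iterφ-overlapFree′ (k ∸ h) h) , iterφ-starts (k ∸ h) h , (T , W≡)) ,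
  greedy⇒lexLeast W T (iterφ-greedy (k ∸ h) h) (iterφ-starts (k ∸ h) h) W≡ T<
  where W = iter (k ∸ h) φ [ h ]
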